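{- Let $1\le\alpha<\omega_1$ and let $U$ be an $\alpha$-rapid ultrafilter on $\omega^\alpha$ such that $\mathrm{fin}^{\otimes\alpha}\subseteq U^*$ and $U$ has the $\mathrm{fin}^{\otimes\alpha}$-pseudo intersection property. Then $U\cdot U\equiv_T U$.
   Context: $\omega^\alpha$ and $\mathrm{fin}^{\otimes\alpha}$: $\omega^1=\omega$, $\mathrm{fin}^{\otimes1}=[\omega]^{<\omega}$; $\omega^{\alpha+1}=\omega\times\omega^\alpha$, $A\in\mathrm{fin}^{\otimes\alpha+1}$ iff for all but finitely many $n$, $(A)_n=\{y:(n,y)\in A\}\in\mathrm{fin}^{\otimes\alpha}$; for limit $\alpha$, with a fixed increasing sequence $\langle\alpha_n\rangle$ of nonzero ordinals cofinal in $\alpha$, $\omega^\alpha=\biguplus_n\{n\}\times\omega^{\alpha_n}$ and $A\in\mathrm{fin}^{\otimes\alpha}$ iff for all but finitely many $n$, $(A)_n\in\mathrm{fin}^{\otimes\alpha_n}$. $U^*=P(\omega^\alpha)\setminus U$. For an ideal $I\subseteq U^*$, $U$ has the $I$-pseudo intersection property if for every $\langle A_n\rangle_{n<\omega}\subseteq U$ there is $A\in U$ with $A\setminus A_n\in I$ for all $n$. An ultrafilter $W$ on $\omega$ is rapid if for every increasing $f:\omega\to\omega$ there is $X\in W$ with $|X\cap f(n)|\le n$ for all $n$; $U$ is $\alpha$-rapid if $\pi_*(U)=\{X\subseteq\omega:\pi^{ -1}X\in U\}$ is rapid, where $\pi:\omega^\alpha\to\omega$ is the projection to the first coordinate (the identity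 when $\alpha=1$). $U$ is ordered by $\supseteq$; $U\cdot U$ is the filter with $A\in U\cdot U$ iff $\{x:\{y:(x,y)\in A\}\in U\}\in U$. $P\le_TQ$ means there is $f:Q\to P$ mapping cofinal subsets to cofinal subsets; $\equiv_T$ is two-way $\le_T$. -}

module Defs where

open import Level using (Level; 0ℓ) renaming (suc to lsuc)
open import Data.Nat using (ℕ; zero; suc; _<_; _≤_)
open import Data.Product using (Σ; ∃; ∃-syntax; _×_; _,_; proj₁)
open import Data.List using (List; length)
open import Data.List.Relation.Unary.All using (All)
open import Data.List.Relation.Unary.Unique.Propositional using (Unique)
open import Data.Empty using (⊥)
open import Data.Unit using (⊤)
open import Relation.Nullary using (¬_)
open import Relation.Binary.PropositionalEquality using (_≡_)
open import Data.Sum using (_⊎_)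

-- Countable ordinals ≥ 1 as Brouwer trees (base = 1); a limit node
-- carries its fixed cofinal sequence ⟨α_n⟩.

data Ord : Set where
  one  : Ord
  succ : Ord → Ord
  lim  : (ℕ → Ord) → Ord

data _≤ₒ_ : Ord → Ord → Set where
  one≤  : ∀ {β} → one ≤ₒ β
  s≤s   : ∀ {α β} → α ≤ₒ β → succ α ≤ₒ succ β
  ≤lim  : ∀ {α f} n → α ≤ₒ f n → α ≤ₒ lim f
  lim≤  : ∀ {f β} → (∀ n → f n ≤ₒ β) → lim f ≤ₒ β

_<ₒ_ : Ord → Ord → Set
α <ₒ β = succ α ≤ₒ β

WF : Ord → Set
WF one      = ⊤
WF (succ α) = WF α
WF (lim f)  = (∀ n → WF (f n)) × (∀ n → f n <ₒ f (suc n))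

Pt : Ord → Set
Pt one      = ℕ
Pt (succ α) = ℕ × Pt α
Pt (lim f)  = Σ ℕ (λ n → Pt (f n))

Subset : Set → Set₁
Subset X = X → Set

_⊆_ : {X : Set} → Subset X → Subset X → Set
A ⊆ B = ∀ x → A x → B x

_∖_ : {X : Set} → Subset X → Subset X → Subset X
(A ∖ B) x = A x × ¬ B x

∁ : {X : Set} → Subset X → Subset X
∁ A x = ¬ A x

_∩_ : {X : Set} → Subset X → Subset X → Subset X
(A ∩ B) x = A x × B x

-- [ω]^{<ω}: finite subsets of ω (a subset of ω is finite iff bounded)
FinSet : Subset ℕ → Set
FinSet A = ∃[ N ] (∀ x → A x → x < N)

FinT : (α : Ord) → Subset (Pt α) → Set
FinT one      A = FinSet A
FinT (succ α) A = ∃[ N ] (∀ n → N ≤ n → FinT α (λ y → A (n , y)))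
FinT (lim f)  A = ∃[ N ] (∀ n → N ≤ n → FinT (f n) (λ y → A (n , y)))

π : (α : Ord) → Pt α → ℕ
π one      x = x
π (succ α) x = proj₁ x
π (lim f)  x = proj₁ x

record IsUltrafilter {X : Set} (U : Subset X → Set) : Set₁ where
  field
    full   : U (λ _ → ⊤)
    proper : ¬ U (λ _ → ⊥)
    upward : ∀ {A B} → A ⊆ B → U A → U B
    meet   : ∀ {A B} → U A → U B → U (A ∩ B)
    ultra  : ∀ A → U A ⊎ U (∁ A)

-- U* = P(X) \ U ; ideal I ⊆ U*
_⊆U* : {X : Set} → (Subset X → Set) → (Subset X → Set) → Set₁
(I ⊆U*) U = ∀ A → I A → ¬ U A

PseudoIntersectionProperty : {X : Set} (I : Subset X → Set) (U : Subset X → Set) → Set₁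
PseudoIntersectionProperty I U =
  (As : ℕ → Subset _) → (∀ n → U (As n)) →
  ∃[ A ] (U A × (∀ n → I (A ∖ As n)))

StrictlyIncreasing : (ℕ → ℕ) → Set
StrictlyIncreasing f = ∀ m n → m < n → f m < f n

-- |X ∩ k| ≤ n : every duplicate-free list of elements of X below k has length ≤ n
CardBelow≤ : Subset ℕ → ℕ → ℕ → Set
CardBelow≤ X k n = (xs : List ℕ) → Unique xs → All (λ x → X x × x < k) xs → length xs ≤ n

Rapid : (Subset ℕ → Set) → Set₁
Rapid W = (f : ℕ → ℕ) → StrictlyIncreasing f →
  ∃[ X ] (W X × (∀ n → CardBelow≤ X (f n) n))

pushforward : {X : Set} → (X → ℕ) → (Subset X → Set) → (Subset ℕ → Set)
pushforward p U Y = U (λ x → Y (p x))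

αRapid : (α : Ord) → (Subset (Pt α) → Set) → Set₁
αRapid α U = Rapid (pushforward (π α) U)

_·_ : {X : Set} → (Subset X → Set) → (Subset X → Set) → (Subset (X × X) → Set)
(U · V) A = U (λ x → V (λ y → A (x , y)))

El : {X : Set} → (Subset X → Set) → Set₁
El {X} U = Σ (Subset X) U

_≼_ : {X : Set} {U : Subset X → Set} → El U → El U → Set
(A , _) ≼ (B , _) = B ⊆ A

Cofinal : {X : Set} (U : Subset X → Set) → (El U → Set₁) → Set₁
Cofinal U C = ∀ p → ∃[ c ] (C c × p ≼ c)

Image : {X Y : Set} {U : Subset X → Set} {V : Subset Y → Set} →
        (El V → El U) → (El V → Set₁) → (El U → Set₁)
Image f C p = ∃[ q ] (C q × f q ≡ p)

_≤T_ : {X Y : Set} → (Subset X → Set) → (Subset Y → Set) → Set₂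
_≤T_ {X} {Y} U V = ∃[ f ] (∀ (C : El V → Set₁) → Cofinal V C → Cofinal U (Image {U = U} {V = V} f C))

_≡T_ : {X Y : Set} → (Subset X → Set) → (Subset Y → Set) → Set₂
U ≡T V = (U ≤T V) × (V ≤T U)

{-# OPTIONS --safe #-}
-- U ≤T U·U through the first projection of a set of pairs.  For the converse,
-- send A ∈ U to the set of pairs (x , y) in A² such that more than code x values
-- of π on A lie below π y, where code enumerates ω^α.  This map is monotone, and
-- it is cofinal: given P ∈ U·U, the pseudo intersection property yields A₀ ∈ U
-- almost contained in every section P_x that lies in U, and since fin^{⊗α} is
-- closed under diagonal unions we may shrink A₀ so that y ∈ P_x as soon as π y
-- passes a threshold N (code x).  Rapidity, applied to an increasing majorant of
-- N, makes the selected pairs satisfy exactly this.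
module Submission where

open import Defs
open import Function using (_∘_)
open import Data.Nat using (ℕ; zero; suc; _<_; _≤_; _+_; _⊔_; z≤n; s≤s; s≤s⁻¹; _≤?_)
open import Data.Nat.Properties
open import Data.Product using (Σ; ∃-syntax; _×_; _,_; proj₁; proj₂)
open import Data.List using ([]; _∷_; length)
open import Data.List.Relation.Unary.All as All using (All; []; _∷_)
open import Data.List.Relation.Unary.AllPairs using ([]; _∷_)
open import Data.List.Relation.Unary.Unique.Propositional using (Unique)
open import Data.Empty using (⊥; ⊥-elim)
open import Data.Sum using (_⊎_; inj₁; inj₂)
open import Relation.Nullary using (¬_; Dec; yes; no)
open import Relation.Nullary.Negation using (¬¬-map)
open import Relation.Binary.PropositionalEquality using (_≡_; refl; sym; trans; cong; subst; module ≡-Reasoning)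

monotone-cofinal⇒≤T : {X Y : Set} {U : Subset X → Set} {V : Subset Y → Set} (f : El V → El U) →
  (∀ a b → _≼_ {U = V} a b → _≼_ {U = U} (f a) (f b)) →
  (∀ p → ∃[ q ] (_≼_ {U = U} p (f q))) → U ≤T V
monotone-cofinal⇒≤T f mono cof = f , λ C cofC p →
  let (q , p≼fq) = cof p
      (c , Cc , q≼c) = cofC q
  in f c , (c , Cc , refl) , λ x fcx → p≼fq x (mono q c q≼c x fcx)

¬¬-→ : {A B : Set} → (A → ¬ ¬ B) → ¬ ¬ (A → B)
¬¬-→ f k = k (λ a → ⊥-elim (f a (λ b → k (λ _ → b))))

¬¬-bounded-∀ : (P : ℕ → Set) (n : ℕ) → (∀ k → k < n → ¬ ¬ P k) → ¬ ¬ (∀ k → k < n → P k)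
¬¬-bounded-∀ P zero _ k = k (λ _ ())
¬¬-bounded-∀ P (suc n) h k =
  ¬¬-bounded-∀ P n (λ j j<n → h j (m<n⇒m<1+n j<n)) λ below →
  h n ≤-refl λ Pn → k (extend below Pn)
  where
  extend : (∀ j → j < n → P j) → P n → ∀ j → j < suc n → P j
  extend below Pn j j<1+n with m<1+n⇒m<n∨m≡n j<1+n
  ... | inj₁ j<n = below j j<n
  ... | inj₂ refl = Pn

module UltrafilterProperties {X : Set} {U : Subset X → Set} (uf : IsUltrafilter U) where
  open IsUltrafilter uf

  nonempty : ∀ {A} → U A → ¬ ¬ Σ X A
  nonempty uA noPoint = proper (upward (λ x Ax → noPoint (x , Ax)) uA)

  meetsAll⇒∈ : ∀ {S} → (∀ {D} → U D → ¬ ¬ Σ X (D ∩ S)) → U S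
  meetsAll⇒∈ {S} meets with ultra S
  ... | inj₁ uS = uS
  ... | inj₂ u∁S = ⊥-elim (meets u∁S λ (_ , ¬Sx , Sx) → ¬Sx Sx)

  guard-∈ : ∀ S → U (λ x → U S → S x)
  guard-∈ S with ultra S
  ... | inj₁ uS = upward (λ _ Sx _ → Sx) uS
  ... | inj₂ u∁S = upward (λ _ _ uS → ⊥-elim (proper (upward (λ _ (Sx , ¬Sx) → ¬Sx Sx) (meet uS u∁S)))) full

  ∁-∈ : ∀ {I A} → (I ⊆U*) U → I A → U (∁ A)
  ∁-∈ {A = A} I⊆U* iA with ultra A
  ... | inj₁ uA = ⊥-elim (I⊆U* A iA uA)
  ... | inj₂ u∁A = u∁A

domain : {X : Set} → Subset (X × X) → Subset X
domain P x = ∃[ y ] P (x , y)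

≤T-square : {X : Set} {U : Subset X → Set} → IsUltrafilter U → U ≤T (U · U)
≤T-square {U = U} uf = monotone-cofinal⇒≤T (λ (P , uP) → domain P , domain-∈ uP)
  (λ _ _ P′⊆P x (y , Pxy) → y , P′⊆P (x , y) Pxy)
  (λ (A , uA) → ((A ∘ proj₁) , upward (λ _ Ax → upward (λ _ _ → Ax) full) uA) , λ _ (_ , Ax) → Ax)
  where
  open IsUltrafilter uf
  open UltrafilterProperties uf

  domain-∈ : ∀ {P} → (U · U) P → U (domain P)
  domain-∈ uP = meetsAll⇒∈ λ uD noPoint →
    nonempty (meet uD uP) λ (x , Dx , uPx) →
    nonempty uPx λ (y , Pxy) → noPoint (x , Dx , y , Pxy)

CardBelow≥ : Subset ℕ → ℕ → ℕ → Set
CardBelow≥ S m n = ∃[ xs ] (Unique xs × All (λ x → S x × x < m) xs × n ≤ length xs)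

CardBelow≥-mono : ∀ {S S′ m m′ n} → S ⊆ S′ → m ≤ m′ → CardBelow≥ S m n → CardBelow≥ S′ m′ n
CardBelow≥-mono S⊆S′ m≤m′ (xs , unique , below , n≤len) =
  xs , unique , All.map (λ (Sx , x<m) → S⊆S′ _ Sx , <-≤-trans x<m m≤m′) below , n≤len

CardBelow≤∧≥⇒≤ : ∀ {S m m′ n} → CardBelow≤ S m n → CardBelow≥ S m′ (suc n) → m ≤ m′
CardBelow≤∧≥⇒≤ {m = m} {m′} few many with m ≤? m′
... | yes m≤m′ = m≤m′
... | no m≰m′ =
  let (xs , unique , below , n<len) = CardBelow≥-mono (λ _ Sx → Sx) (<⇒≤ (≰⇒> m≰m′)) many
  in ⊥-elim (≤⇒≯ (few xs unique below) n<len)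

Unbounded : Subset ℕ → Set
Unbounded S = ∀ m → ¬ ¬ (∃[ x ] (S x × m ≤ x))

unbounded⇒CardBelow≥ : ∀ {S} → Unbounded S → ∀ n → ¬ ¬ (∃[ m ] CardBelow≥ S m n)
unbounded⇒CardBelow≥ unb zero k = k (0 , [] , [] , [] , z≤n)
unbounded⇒CardBelow≥ unb (suc n) k =
  unbounded⇒CardBelow≥ unb n λ (m , xs , unique , below , n≤len) →
  unb m λ (x , Sx , m≤x) →
  k (suc x , x ∷ xs ,
     All.map (λ (_ , y<m) x≡y → <⇒≢ (<-≤-trans y<m m≤x) (sym x≡y)) below ∷ unique ,
     (Sx , ≤-refl) ∷ All.map (λ (Sy , y<m) → Sy , m<n⇒m<1+n (<-≤-trans y<m m≤x)) below ,
     s≤s n≤len)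

step⇒StrictlyIncreasing : ∀ {f} → (∀ n → f n < f (suc n)) → StrictlyIncreasing f
step⇒StrictlyIncreasing step m zero ()
step⇒StrictlyIncreasing step m (suc n) m<1+n with m<1+n⇒m<n∨m≡n m<1+n
... | inj₁ m<n = <-trans (step⇒StrictlyIncreasing step m n m<n) (step n)
... | inj₂ refl = step n

majorant : (ℕ → ℕ) → ℕ → ℕ
majorant N zero = N 0
majorant N (suc n) = suc (majorant N n + N (suc n))

majorant-strictlyIncreasing : ∀ N → StrictlyIncreasing (majorant N)
majorant-strictlyIncreasing N = step⇒StrictlyIncreasing λ n → s≤s (m≤m+n _ _)

n≤majorant : ∀ N n → n ≤ majorant N n
n≤majorant N zero = z≤n
n≤majorant N (suc n) = s≤s (≤-trans (n≤majorant N n) (m≤m+n _ _))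

N≤majorant : ∀ N n → N n ≤ majorant N n
N≤majorant N zero = ≤-refl
N≤majorant N (suc n) = m≤n⇒m≤1+n (m≤n+m _ _)

DiagonalUnion : {X : Set} → (X → ℕ) → (ℕ → ℕ) → (ℕ → Subset X) → Subset X
DiagonalUnion p N F x = ∃[ k ] (k ≤ p x × N k ≤ p x × F k x)

module SquareBelow
  {X : Set} (p : X → ℕ)
  (code : X → ℕ) (decode : ℕ → X) (decode-code : ∀ x → decode (code x) ≡ x)
  (I : Subset X → Set)
  (I-bounded : ∀ m → I (λ x → p x < m))
  (I-diagonal : ∀ F → (∀ k → I (F k)) → ∃[ N ] I (DiagonalUnion p N F))
  {U : Subset X → Set} (uf : IsUltrafilter U) (I⊆U* : (I ⊆U*) U)
  (rapid : Rapid (pushforward p U)) (pip : PseudoIntersectionProperty I U)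
  where
  open IsUltrafilter uf
  open UltrafilterProperties uf

  far : ∀ {A} → U A → ∀ m → ¬ ¬ (∃[ x ] (A x × m ≤ p x))
  far uA m = nonempty (meet uA (upward (λ _ px≮m → ≮⇒≥ px≮m) (∁-∈ I⊆U* (I-bounded m))))

  p[_] : Subset X → Subset ℕ
  p[ A ] n = ∃[ x ] (A x × p x ≡ n)

  p[]-unbounded : ∀ {A} → U A → Unbounded p[ A ]
  p[]-unbounded uA m = ¬¬-map (λ (x , Ax , m≤px) → p x , (x , Ax , refl) , m≤px) (far uA m)

  wide : Subset X → Subset (X × X)
  wide A (x , y) = A x × A y × CardBelow≥ p[ A ] (p y) (suc (code x))

  wide-mono : ∀ {A B} → A ⊆ B → wide A ⊆ wide B
  wide-mono A⊆B (x , y) (Ax , Ay , many) =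
    A⊆B x Ax , A⊆B y Ay , CardBelow≥-mono (λ _ (w , Aw , pw) → w , A⊆B w Aw , pw) ≤-refl many

  wide-∈ : ∀ {A} → U A → (U · U) (wide A)
  wide-∈ {A} uA = upward (λ x Ax → meetsAll⇒∈ λ uD noPoint →
    unbounded⇒CardBelow≥ (p[]-unbounded (meet uD uA)) (suc (code x)) λ (m , many) →
       far (meet uD uA) m λ (y , (Dy , Ay) , m≤py) →
       noPoint (y , Dy , Ax , Ay ,
                CardBelow≥-mono (λ _ (w , (_ , Aw) , pw) → w , Aw , pw) m≤py many)) uA

  section : Subset (X × X) → ℕ → Subset X
  section P k y = P (decode k , y)

  guarded : Subset (X × X) → ℕ → Subset X
  guarded P k y = U (section P k) → section P k y

  Catches : Subset (X × X) → (ℕ → ℕ) → Subset X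
  Catches P N y = ∀ k → k ≤ p y → N k ≤ p y → guarded P k y

  catching : ∀ P → ∃[ N ] U (Catches P N)
  catching P with pip (guarded P) (λ k → guard-∈ (section P k))
  ... | A₀ , uA₀ , A₀∖guarded∈I with I-diagonal (λ k → A₀ ∖ guarded P k) A₀∖guarded∈I
  ... | N , diagonal∈I = N , meetsAll⇒∈ λ uD noPoint →
    nonempty (meet uD (meet uA₀ (∁-∈ I⊆U* diagonal∈I))) λ (y , Dy , A₀y , ¬diagonal) →
    ¬¬-bounded-∀ _ (suc (p y))
      (λ k k<1+py → ¬¬-→ λ Nk≤py ¬guarded → ¬diagonal (k , s≤s⁻¹ k<1+py , Nk≤py , A₀y , ¬guarded))
      (λ catches → noPoint (y , Dy , λ k k≤py → catches k (s≤s k≤py)))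

  wide-cofinal : ∀ {P} → (U · U) P → ∃[ A ] (U A × wide A ⊆ P)
  wide-cofinal {P} uP with catching P
  ... | N , uCatches with rapid (majorant N) (majorant-strictlyIncreasing N)
  ... | R , uR , sparse = A , meet (meet uCatches uP) uR , wide⊆P
    where
    A : Subset X
    A x = (Catches P N x × U (λ y → P (x , y))) × R (p x)

    wide⊆P : wide A ⊆ P
    wide⊆P (x , y) (((_ , uPx) , _) , ((catches , _) , _) , many) =
      subst (λ x′ → P (x′ , y)) (decode-code x)
        (catches (code x) (≤-trans (n≤majorant N (code x)) g≤py) (≤-trans (N≤majorant N (code x)) g≤py)
          (subst (λ x′ → U (λ z → P (x′ , z))) (sym (decode-code x)) uPx))
      where
      g≤py : majorant N (code x) ≤ p y
      g≤py = CardBelow≤∧≥⇒≤ (sparse (code x))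
               (CardBelow≥-mono (λ { _ (_ , (_ , Rpw) , refl) → Rpw }) ≤-refl many)

  square-≤T : (U · U) ≤T U
  square-≤T = monotone-cofinal⇒≤T (λ (A , uA) → wide A , wide-∈ uA)
    (λ (A , _) (B , _) B⊆A → wide-mono B⊆A)
    (λ (P , uP) → let (A , uA , wide⊆P) = wide-cofinal uP in (A , uA) , wide⊆P)

triangle : ℕ → ℕ
triangle zero = zero
triangle (suc d) = triangle d + suc d

pair : ℕ → ℕ → ℕ
pair a b = triangle (a + b) + a

-- successor in the Cantor enumeration (0,0), (0,1), (1,0), (0,2), (1,1), …
next : ℕ × ℕ → ℕ × ℕ
next (a , suc b) = suc a , b
next (a , zero) = zero , suc a

unpair : ℕ → ℕ × ℕ
unpair zero = 0 , 0
unpair (suc n) = next (unpair n)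

unpair-triangle : ∀ d a b → a + b ≡ d → unpair (triangle d + a) ≡ (a , b)
unpair-triangle zero zero b refl = refl
unpair-triangle (suc d) zero b a+b≡d = begin
  unpair (triangle d + suc d + 0) ≡⟨ cong unpair (trans (+-identityʳ _) (+-suc (triangle d) d)) ⟩
  next (unpair (triangle d + d))  ≡⟨ cong next (unpair-triangle d d 0 (+-identityʳ d)) ⟩
  (0 , suc d)                     ≡⟨ cong (0 ,_) (sym a+b≡d) ⟩
  (0 , b)                         ∎
  where open ≡-Reasoning
unpair-triangle d (suc a) b a+b≡d = begin
  unpair (triangle d + suc a)  ≡⟨ cong unpair (+-suc (triangle d) a) ⟩
  next (unpair (triangle d + a)) ≡⟨ cong next (unpair-triangle d a (suc b) (trans (+-suc a b) a+b≡d)) ⟩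
  (suc a , b)                  ∎
  where open ≡-Reasoning

unpair-pair : ∀ a b → unpair (pair a b) ≡ (a , b)
unpair-pair a b = unpair-triangle (a + b) a b refl

code : ∀ α → Pt α → ℕ
code one x = x
code (succ α) (n , y) = pair n (code α y)
code (lim f) (n , y) = pair n (code (f n) y)

decode : ∀ α → ℕ → Pt α
decode one k = k
decode (succ α) k = proj₁ (unpair k) , decode α (proj₂ (unpair k))
decode (lim f) k = proj₁ (unpair k) , decode (f (proj₁ (unpair k))) (proj₂ (unpair k))

decode-code : ∀ α x → decode α (code α x) ≡ x
decode-code one x = refl
decode-code (succ α) (n , y) rewrite unpair-pair n (code α y) | decode-code α y = refl
decode-code (lim f) (n , y) rewrite unpair-pair n (code (f n) y) | decode-code (f n) y = refl

FinT-⊆ : ∀ α {A B} → A ⊆ B → FinT α B → FinT α A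
FinT-⊆ one A⊆B (N , bound) = N , λ x Ax → bound x (A⊆B x Ax)
FinT-⊆ (succ α) A⊆B (N , fibres) = N , λ n N≤n → FinT-⊆ α (λ y → A⊆B (n , y)) (fibres n N≤n)
FinT-⊆ (lim f) A⊆B (N , fibres) = N , λ n N≤n → FinT-⊆ (f n) (λ y → A⊆B (n , y)) (fibres n N≤n)

FinT-∅ : ∀ α → FinT α (λ _ → ⊥)
FinT-∅ one = 0 , λ _ ()
FinT-∅ (succ α) = 0 , λ _ _ → FinT-∅ α
FinT-∅ (lim f) = 0 , λ n _ → FinT-∅ (f n)

FinT-∪ : ∀ α {A B} → FinT α A → FinT α B → FinT α (λ x → A x ⊎ B x)
FinT-∪ one (N , boundA) (N′ , boundB) = N ⊔ N′ , λ
  { x (inj₁ Ax) → <-≤-trans (boundA x Ax) (m≤m⊔n N N′)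
  ; x (inj₂ Bx) → <-≤-trans (boundB x Bx) (m≤n⊔m N N′) }
FinT-∪ (succ α) (N , fibresA) (N′ , fibresB) = N ⊔ N′ , λ n ≤n →
  FinT-∪ α (fibresA n (m⊔n≤o⇒m≤o N N′ ≤n)) (fibresB n (m⊔n≤o⇒n≤o N N′ ≤n))
FinT-∪ (lim f) (N , fibresA) (N′ , fibresB) = N ⊔ N′ , λ n ≤n →
  FinT-∪ (f n) (fibresA n (m⊔n≤o⇒m≤o N N′ ≤n)) (fibresB n (m⊔n≤o⇒n≤o N N′ ≤n))

FinT-bounded : ∀ α m → FinT α (λ x → π α x < m)
FinT-bounded one m = m , λ _ x<m → x<m
FinT-bounded (succ α) m = m , λ n m≤n → FinT-⊆ α (λ _ n<m → <⇒≱ n<m m≤n) (FinT-∅ α)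
FinT-bounded (lim f) m = m , λ n m≤n → FinT-⊆ (f n) (λ _ n<m → <⇒≱ n<m m≤n) (FinT-∅ (f n))

FinT-guarded : ∀ α {A} {Q : Set} → Dec Q → (Q → FinT α A) → FinT α (λ x → Q × A x)
FinT-guarded α (yes q) fin = FinT-⊆ α (λ _ → proj₂) (fin q)
FinT-guarded α (no ¬q) _ = FinT-⊆ α (λ _ (q , _) → ¬q q) (FinT-∅ α)

FinT-⋃≤ : ∀ α n (F : ℕ → Subset (Pt α)) → (∀ k → k ≤ n → FinT α (F k)) →
  FinT α (λ x → ∃[ k ] (k ≤ n × F k x))
FinT-⋃≤ α zero F fin = FinT-⊆ α (λ { _ (_ , z≤n , F0x) → F0x }) (fin 0 z≤n)
FinT-⋃≤ α (suc n) F fin =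
  FinT-⊆ α split (FinT-∪ α (FinT-⋃≤ α n F (λ k k≤n → fin k (m≤n⇒m≤1+n k≤n))) (fin (suc n) ≤-refl))
  where
  split : ∀ x → ∃[ k ] (k ≤ suc n × F k x) → ∃[ k ] (k ≤ n × F k x) ⊎ F (suc n) x
  split x (k , k≤1+n , Fkx) with m≤n⇒m<n∨m≡n k≤1+n
  ... | inj₁ k<1+n = inj₁ (k , s≤s⁻¹ k<1+n , Fkx)
  ... | inj₂ refl = inj₂ Fkx

-- FinT (succ α) is Tail (λ _ → α) and FinT (lim f) is Tail f, definitionally.
Tail : (β : ℕ → Ord) → Subset (Σ ℕ (Pt ∘ β)) → Set
Tail β A = ∃[ N ] (∀ n → N ≤ n → FinT (β n) (λ y → A (n , y)))

tail-diagonal : ∀ β (F : ℕ → Subset (Σ ℕ (Pt ∘ β))) (fin : ∀ k → Tail β (F k)) n →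
  FinT (β n) (λ y → ∃[ k ] (k ≤ n × proj₁ (fin k) ≤ n × F k (n , y)))
tail-diagonal β F fin n = FinT-⋃≤ (β n) n _ λ k _ →
  FinT-guarded (β n) (proj₁ (fin k) ≤? n) (proj₂ (fin k) n)

FinT-diagonal : ∀ α F → (∀ k → FinT α (F k)) → ∃[ N ] FinT α (DiagonalUnion (π α) N F)
FinT-diagonal one F fin = (λ k → proj₁ (fin k)) , 0 ,
  λ { x (k , _ , Nk≤x , Fkx) → ⊥-elim (<⇒≱ (proj₂ (fin k) x Fkx) Nk≤x) }
FinT-diagonal (succ α) F fin = (λ k → proj₁ (fin k)) , 0 , λ n _ → tail-diagonal (λ _ → α) F fin n
FinT-diagonal (lim f) F fin = (λ k → proj₁ (fin k)) , 0 , λ n _ → tail-diagonal f F fin n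

corollary3p5 : (α : Ord) → WF α → (U : Subset (Pt α) → Set) →
    IsUltrafilter U → αRapid α U → (FinT α ⊆U*) U →
    PseudoIntersectionProperty (FinT α) U →
    (U · U) ≡T U
corollary3p5 α _ U uf rapid FinT⊆U* pip =
  SquareBelow.square-≤T (π α) (code α) (decode α) (decode-code α)
    (FinT α) (FinT-bounded α) (FinT-diagonal α) uf FinT⊆U* rapid pip
  , ≤T-square uf
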